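{- For all $n\geq0$ and $\sigma\in\{231,312\}$, $j_n(\{123,\sigma\})=1+\left\lfloor\frac{(n-1)^2}{4}\right\rfloor$.
   Context: A permutation of a finite set $S$ of positive integers is a word in which each element of $S$ appears exactly once; $\mathfrak{S}_n$ is the set of permutations of $\{1,\dots,n\}$. For a permutation $\pi$ and a letter $x$ of $\pi$, $\rho_\pi(x)$ is the maximal consecutive subword of $\pi$ consisting of the letters immediately to the right of $x$ that are all larger than $x$. $\pi$ is Jacobi if $|\rho_\pi(x)|$ is even for all letters $x$. A permutation $\pi$ avoids a pattern $\sigma$ if no subword of $\pi$ has standardization (relative order) $\sigma$. For a set $\Pi$ of patterns, $j_n(\Pi)$ is the number of Jacobi permutations in $\mathfrak{S}_n$ avoiding every pattern in $\Pi$. -}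

module Defs where

open import Data.Nat using (ℕ; zero; suc; _<_; _∸_; _*_; _+_; _/_)
open import Data.Nat.Properties using (_<?_)
open import Data.Nat.Divisibility using (_∣_)
open import Data.List using (List; []; _∷_; length; map; upTo; takeWhile)
open import Data.List.Relation.Binary.Pointwise using (Pointwise)
open import Data.List.Relation.Binary.Sublist.Propositional using (_⊆_)
open import Data.List.Relation.Binary.Permutation.Propositional using (_↭_)
open import Data.List.Relation.Unary.Unique.Propositional using (Unique)
open import Data.List.Membership.Propositional using (_∈_)
open import Data.Product using (_×_; ∃)
open import Data.Unit using (⊤)
open import Data.Empty using (⊥)
open import Relation.Nullary using (¬_)
open import Function.Bundles using (_⇔_)
open import Relation.Binary.PropositionalEquality using (_≡_)

IsPermOf : ℕ → List ℕ → Set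
IsPermOf n π = π ↭ map suc (upTo n)

ρ : ℕ → List ℕ → List ℕ
ρ x rest = takeWhile (x <?_) rest

Jacobi : List ℕ → Set
Jacobi []         = ⊤
Jacobi (x ∷ rest) = (2 ∣ length (ρ x rest)) × Jacobi rest

-- w and σ have the same relative order (standardization) :
-- same length and for all positions i < j, w_i < w_j ⇔ σ_i < σ_j
SameOrder : List ℕ → List ℕ → Set
SameOrder []       []       = ⊤
SameOrder []       (_ ∷ _)  = ⊥
SameOrder (_ ∷ _)  []       = ⊥
SameOrder (a ∷ as) (b ∷ bs) =
  Pointwise (λ x y → (a < x) ⇔ (b < y)) as bs × SameOrder as bs

Contains : List ℕ → List ℕ → Set
Contains π σ = ∃ λ w → (w ⊆ π) × SameOrder w σ

Avoids : List ℕ → List ℕ → Set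
Avoids π σ = ¬ Contains π σ

AvoidsAll : List ℕ → List (List ℕ) → Set
AvoidsAll π []       = ⊤
AvoidsAll π (σ ∷ Π)  = Avoids π σ × AvoidsAll π Π

JacobiAvoider : ℕ → List (List ℕ) → List ℕ → Set
JacobiAvoider n Π π = IsPermOf n π × Jacobi π × AvoidsAll π Π

JCount : ℕ → List (List ℕ) → ℕ → Set
JCount n Π k = ∃ λ (L : List (List ℕ)) →
  Unique L × (∀ π → (π ∈ L) ⇔ JacobiAvoider n Π π) × length L ≡ k

-- Let π = x π′ be a Jacobi permutation of 1 … N avoiding 123 and σ. Avoiding 123 forces
-- the letters above x to appear in decreasing order. For σ = 312 the letters below x
-- decrease as well (x would head a 312) and none of them sits between two letters above
-- x, so π = (b+i+1 … b+1)(N … b+i+2)(b … 1). For σ = 231 and x < N every letter below x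
-- precedes every letter above x, and they decrease because of 123 with N: the same shape
-- with b = 0. Such a permutation is Jacobi iff its top run has even length, since b + 1
-- is the only letter followed by a larger one. Hence the 231-avoiders of size N are the
-- N τ with τ an avoider of size N − 1, together with the shapes with b = 0; the
-- 312-avoiders of size N are those of size N − 1 with every letter raised and 1 appended
-- (covering N … 1 and b > 0), together with the same shapes. There are ⌊(N − 1)/2⌋ of
-- these, so j_N = 1 + Σ_{k<N} ⌊k/2⌋ = 1 + ⌊(N − 1)²/4⌋.

module Submission where

open import Defs
open import Data.Empty using (⊥; ⊥-elim)
open import Data.Nat
  using (ℕ; zero; suc; _+_; _*_; _∸_; _/_; _<_; _≤_; z≤n; s≤s; z<s; s<s; _<?_; ⌊_/2⌋; ⌈_/2⌉)
open import Data.Nat.Properties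
open import Data.Nat.Divisibility using (_∣_; divides)
open import Data.Nat.DivMod using (m*n/n≡m; +-distrib-/-∣ʳ)
open import Data.Nat.Solver using (module +-*-Solver)
open import Data.List using (List; []; _∷_; _++_; [_]; map; length; upTo)
open import Data.List.Properties
  using (++-assoc; ++-identityʳ; ∷-injectiveˡ; ∷-injectiveʳ; ∷ʳ-injective; map-++;
         map-injective; length-++; length-map; length-upTo; upTo-∷ʳ)
open import Data.List.Membership.Propositional using (_∈_)
open import Data.List.Membership.Propositional.Properties
  using (∈-++⁺ˡ; ∈-++⁺ʳ; ∈-++⁻; ∈-map⁺; ∈-map⁻; ∈-upTo⁺; ∈-upTo⁻)
open import Data.List.Membership.Propositional.Properties.WithK using (unique∧set⇒bag)
open import Data.List.Relation.Unary.All as All using (All; []; _∷_)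
open import Data.List.Relation.Unary.All.Properties using () renaming (++⁺ to All-++⁺)
open import Data.List.Relation.Unary.Any using (here; there)
open import Data.List.Relation.Unary.AllPairs using ([]; _∷_)
open import Data.List.Relation.Unary.Unique.Propositional using (Unique)
import Data.List.Relation.Unary.Unique.Propositional.Properties as Unique
open import Data.List.Relation.Binary.Sublist.Propositional
  using (_⊆_; []; _∷_; _∷ʳ_; ⊆-refl; ⊆-trans; from∈; to∈; lookup)
open import Data.List.Relation.Binary.Sublist.Propositional.Properties
  using (∷ˡ⁻; ++⁺ˡ; ++⁺ʳ; All-resp-⊆) renaming (++⁺ to ⊆-++⁺)
open import Data.List.Relation.Binary.Permutation.Propositional as ↭
  using (_↭_; ↭-sym; ↭-trans; ↭-reflexive)
open import Data.List.Relation.Binary.Permutation.Propositional.Properties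
  using (∈-resp-↭; All-resp-↭; ↭-length; drop-∷; ∷↭∷ʳ; shifts)
open import Data.List.Relation.Binary.BagAndSetEquality using (∼bag⇒↭)
open import Data.Product using (_×_; _,_; proj₁; proj₂; ∃; ∃₂; uncurry; map₂)
open import Data.Sum using (_⊎_; inj₁; inj₂; swap)
open import Data.Unit using (tt)
open import Function using (_∘_; case_of_)
open import Function.Bundles using (_⇔_; mk⇔; Equivalence)
open import Function.Properties.Equivalence using () renaming (refl to ⇔-refl; sym to ⇔-sym; trans to ⇔-trans)
open import Relation.Nullary using (¬_; yes; no)
open import Data.List.Relation.Binary.Pointwise using ([]; _∷_)
open import Relation.Nullary.Decidable using (dec-true; dec-false)
open import Relation.Binary.Definitions using (tri<; tri≈; tri>)
open import Relation.Binary.PropositionalEquality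
  using (_≡_; _≢_; refl; sym; trans; cong; cong₂; subst; module ≡-Reasoning)

open Equivalence using (to; from)

variable
  a b i j k m n N p q w x y z : ℕ
  p₁ p₂ p₃ : ℕ
  xs ys zs π τ σ : List ℕ

-- Lists and sublists

Decreasing : List ℕ → Set
Decreasing ys = ∀ {p q} → p ∷ q ∷ [] ⊆ ys → q < p

pair-++ : ∀ xs → p ∷ q ∷ [] ⊆ xs ++ ys →
          p ∷ q ∷ [] ⊆ xs ⊎ p ∷ q ∷ [] ⊆ ys ⊎ (p ∈ xs × q ∈ ys)
pair-++ []       s = inj₂ (inj₁ s)
pair-++ (x ∷ xs) (.x ∷ʳ s) with pair-++ xs s
... | inj₁ s′                = inj₁ (x ∷ʳ s′)
... | inj₂ (inj₁ s′)         = inj₂ (inj₁ s′)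
... | inj₂ (inj₂ (p∈ , q∈)) = inj₂ (inj₂ (there p∈ , q∈))
pair-++ (x ∷ xs) (refl ∷ s) with ∈-++⁻ xs (to∈ s)
... | inj₁ q∈ = inj₁ (refl ∷ from∈ q∈)
... | inj₂ q∈ = inj₂ (inj₂ (here refl , q∈))

Decreasing-⊆ : xs ⊆ ys → Decreasing ys → Decreasing xs
Decreasing-⊆ xs⊆ys dec s = dec (⊆-trans s xs⊆ys)

Decreasing-head : Decreasing (x ∷ xs) → All (_< x) xs
Decreasing-head dec = All.tabulate (λ y∈ → dec (refl ∷ from∈ y∈))

Decreasing-tail : Decreasing (x ∷ xs) → Decreasing xs
Decreasing-tail = Decreasing-⊆ (_ ∷ʳ ⊆-refl)

Decreasing⇒Unique : Decreasing xs → Unique xs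
Decreasing⇒Unique {[]}    _   = []
Decreasing⇒Unique {_ ∷ _} dec = All.map >⇒≢ (Decreasing-head dec) ∷ Decreasing⇒Unique (Decreasing-tail dec)

Decreasing-++ : Decreasing xs → Decreasing ys → (∀ {p q} → p ∈ xs → q ∈ ys → q < p) →
                Decreasing (xs ++ ys)
Decreasing-++ {xs} decx decy xs>ys s with pair-++ xs s
... | inj₁ s′                = decx s′
... | inj₂ (inj₁ s′)         = decy s′
... | inj₂ (inj₂ (p∈ , q∈)) = xs>ys p∈ q∈

Unique-⊆ : xs ⊆ ys → Unique ys → Unique xs
Unique-⊆ []         _          = []
Unique-⊆ (_ ∷ʳ s)   (_ ∷ u)    = Unique-⊆ s u
Unique-⊆ (refl ∷ s) (y∉ ∷ u)   = All-resp-⊆ s y∉ ∷ Unique-⊆ s u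

Unique-pair⇒≢ : Unique ys → p ∷ q ∷ [] ⊆ ys → p ≢ q
Unique-pair⇒≢ u s with Unique-⊆ s u
... | (p≢q ∷ []) ∷ _ = p≢q

no-ascent⇒Decreasing : Unique ys → (∀ {p q} → p ∷ q ∷ [] ⊆ ys → p < q → ⊥) → Decreasing ys
no-ascent⇒Decreasing u no-ascent {p} {q} s with <-cmp p q
... | tri< p<q _ _ = ⊥-elim (no-ascent s p<q)
... | tri≈ _ p≡q _ = ⊥-elim (Unique-pair⇒≢ u s p≡q)
... | tri> _ _ q<p = q<p

compare-with-head : Unique (x ∷ τ) → y ∈ τ → y < x ⊎ x < y
compare-with-head {x} {y = y} (x∉ ∷ _) y∈ with <-cmp y x
... | tri< y<x _ _ = inj₁ y<x
... | tri≈ _ y≡x _ = ⊥-elim (All.lookup x∉ y∈ (sym y≡x))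
... | tri> _ _ x<y = inj₂ x<y

middle-⊆ : ∀ xs ys zs → ys ⊆ xs ++ ys ++ zs
middle-⊆ xs ys zs = ++⁺ˡ {A = ℕ} xs (++⁺ʳ {A = ℕ} zs ⊆-refl)

outer-⊆ : ∀ xs ys zs → xs ++ zs ⊆ xs ++ ys ++ zs
outer-⊆ xs ys zs = ⊆-++⁺ {A = ℕ} (⊆-refl {x = xs}) (++⁺ˡ {A = ℕ} ys ⊆-refl)

split-PQ : ∀ (P Q : ℕ → Set) → (∀ {y} → y ∈ ys → P y ⊎ Q y) →
           (∀ {u v} → u ∷ v ∷ [] ⊆ ys → Q u → P v → ⊥) →
           ∃₂ λ xs zs → ys ≡ xs ++ zs × All P xs × All Q zs
split-PQ {[]}     P Q _   _     = [] , [] , refl , [] , []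
split-PQ {y ∷ ys} P Q P⊎Q no-QP with P⊎Q (here refl)
... | inj₁ Py with split-PQ P Q (P⊎Q ∘ there) (λ s → no-QP (y ∷ʳ s))
...   | xs , zs , refl , Pxs , Qzs = y ∷ xs , zs , refl , Py ∷ Pxs , Qzs
split-PQ {y ∷ ys} P Q P⊎Q no-QP | inj₂ Qy = [] , y ∷ ys , refl , [] , Qy ∷ All.tabulate Q-after
  where
  Q-after : z ∈ ys → Q z
  Q-after z∈ with P⊎Q (there z∈)
  ... | inj₁ Pz = ⊥-elim (no-QP (refl ∷ from∈ z∈) Qy Pz)
  ... | inj₂ Qz = Qz

split-PQP : ∀ (P Q : ℕ → Set) → (∀ {y} → y ∈ ys → P y ⊎ Q y) →
            (∀ {u v w} → u ∷ v ∷ w ∷ [] ⊆ ys → Q u → P v → Q w → ⊥) →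
            ∃₂ λ xs zs → ∃ λ ws → ys ≡ xs ++ zs ++ ws × All P xs × All Q zs × All P ws
split-PQP {[]}     P Q _   _      = [] , [] , [] , refl , [] , [] , []
split-PQP {y ∷ ys} P Q P⊎Q no-QPQ with P⊎Q (here refl)
... | inj₁ Py with split-PQP P Q (P⊎Q ∘ there) (λ s → no-QPQ (y ∷ʳ s))
...   | xs , zs , ws , refl , Pxs , Qzs , Pws = y ∷ xs , zs , ws , refl , Py ∷ Pxs , Qzs , Pws
split-PQP {y ∷ ys} P Q P⊎Q no-QPQ | inj₂ Qy
  with split-PQ Q P (swap ∘ P⊎Q ∘ there) (λ s Pv Qw → no-QPQ (refl ∷ s) Qy Pv Qw)
... | zs , ws , refl , Qzs , Pws = [] , y ∷ zs , ws , refl , [] , Qy ∷ Qzs , Pws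

-- Decreasing runs

desc : ℕ → ℕ → List ℕ
desc zero    a = []
desc (suc k) a = suc (k + a) ∷ desc k a

HasLetters : ℕ → ℕ → List ℕ → Set
HasLetters a b ys = ∀ y → y ∈ ys ⇔ (a < y × y ≤ b)

∈-desc⁻ : ∀ k → y ∈ desc k a → a < y × y ≤ k + a
∈-desc⁻ {a = a} (suc k) (here refl) = s≤s (m≤n+m a k) , ≤-refl
∈-desc⁻ (suc k) (there y∈) = map₂ m≤n⇒m≤1+n (∈-desc⁻ k y∈)

∈-desc⁺ : ∀ k → a < y → y ≤ k + a → y ∈ desc k a
∈-desc⁺ zero a<y y≤a = ⊥-elim (<⇒≱ a<y y≤a)
∈-desc⁺ {a} {y} (suc k) a<y y≤ with y ≟ suc (k + a)
... | yes refl = here refl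
... | no  y≢   = there (∈-desc⁺ k a<y (≤-pred (≤∧≢⇒< y≤ y≢)))

desc-letters : ∀ k a → HasLetters a (k + a) (desc k a)
desc-letters k a y = mk⇔ (∈-desc⁻ k) (uncurry (∈-desc⁺ k))

∈-desc₀⁻ : ∀ k → y ∈ desc k 0 → 0 < y × y ≤ k
∈-desc₀⁻ k y∈ = map₂ (λ y≤ → ≤-trans y≤ (≤-reflexive (+-identityʳ k))) (∈-desc⁻ k y∈)

desc-decreasing : ∀ k a → Decreasing (desc k a)
desc-decreasing (suc k) a (_ ∷ʳ s)   = desc-decreasing k a s
desc-decreasing (suc k) a (refl ∷ s) = s≤s (proj₂ (∈-desc⁻ k (to∈ s)))

HasLetters-∷⁻ : All (suc b ≢_) xs → HasLetters a (suc b) (suc b ∷ xs) → HasLetters a b xs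
HasLetters-∷⁻ {b = b} {xs = xs} {a = a} top∉ letters y = mk⇔ below above
  where
  below : y ∈ xs → a < y × y ≤ b
  below y∈ = map₂ (λ y≤ → ≤-pred (≤∧≢⇒< y≤ (λ y≡ → All.lookup top∉ y∈ (sym y≡)))) (to (letters y) (there y∈))
  above : a < y × y ≤ b → y ∈ xs
  above (a<y , y≤b) with from (letters y) (a<y , m≤n⇒m≤1+n y≤b)
  ... | here refl = ⊥-elim (1+n≰n y≤b)
  ... | there y∈ = y∈

decreasing-letters⇒desc : ∀ k → Decreasing xs → HasLetters a (k + a) xs → xs ≡ desc k a
decreasing-letters⇒desc {[]}    zero    _ _ = refl
decreasing-letters⇒desc {x ∷ _} zero    _ letters = ⊥-elim (uncurry <⇒≱ (to (letters x) (here refl)))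
decreasing-letters⇒desc {[]} {a} (suc k) _ letters with from (letters (suc (k + a))) (s≤s (m≤n+m a k) , ≤-refl)
... | ()
decreasing-letters⇒desc {x ∷ xs} {a} (suc k) dec letters with x≡top
  where
  top≤x : suc (k + a) ≤ x
  top≤x with from (letters (suc (k + a))) (s≤s (m≤n+m a k) , ≤-refl)
  ... | here refl = ≤-refl
  ... | there top∈ = <⇒≤ (All.lookup (Decreasing-head dec) top∈)
  x≡top : x ≡ suc (k + a)
  x≡top = ≤-antisym (proj₂ (to (letters x) (here refl))) top≤x
... | refl = cong (_ ∷_) (decreasing-letters⇒desc k (Decreasing-tail dec)
                            (HasLetters-∷⁻ (All.map >⇒≢ (Decreasing-head dec)) letters))

desc-++ : ∀ k j → desc k j ++ desc j 0 ≡ desc (k + j) 0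
desc-++ zero    j = refl
desc-++ (suc k) j = cong₂ _∷_ (cong suc (sym (+-identityʳ (k + j)))) (desc-++ k j)

desc-++⁻ : ∀ xs → xs ++ ys ≡ desc n 0 → ∃₂ λ k j → n ≡ k + j × xs ≡ desc k j × ys ≡ desc j 0
desc-++⁻ {n = n} [] eq = 0 , n , refl , refl , eq
desc-++⁻ {n = suc n} (x ∷ xs) eq with desc-++⁻ xs (∷-injectiveʳ eq)
... | k , j , refl , refl , ys≡ =
  suc k , j , refl , cong (_∷ desc k j) (trans (∷-injectiveˡ eq) (cong suc (+-identityʳ (k + j)))) , ys≡

map-suc-desc : ∀ k a → map suc (desc k a) ≡ desc k (suc a)
map-suc-desc zero    a = refl
map-suc-desc (suc k) a = cong₂ _∷_ (cong suc (sym (+-suc k a))) (map-suc-desc k a)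

desc-snoc : ∀ k a → desc (suc k) a ≡ desc k (suc a) ++ [ suc a ]
desc-snoc zero    a = refl
desc-snoc (suc k) a = cong₂ _∷_ (cong suc (sym (+-suc k a))) (desc-snoc k a)

length-desc : ∀ k a → length (desc k a) ≡ k
length-desc zero    a = refl
length-desc (suc k) a = cong suc (length-desc k a)

-- Permutations

Unique-resp-↭ : xs ↭ ys → Unique xs → Unique ys
Unique-resp-↭ ↭.refl          u                      = u
Unique-resp-↭ (↭.prep x p)    (x∉ ∷ u)               = All-resp-↭ p x∉ ∷ Unique-resp-↭ p u
Unique-resp-↭ (↭.swap x y p)  ((x≢y ∷ x∉) ∷ y∉ ∷ u) =
  ((x≢y ∘ sym) ∷ All-resp-↭ p y∉) ∷ All-resp-↭ p x∉ ∷ Unique-resp-↭ p u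
Unique-resp-↭ (↭.trans p₁ p₂) u                      = Unique-resp-↭ p₂ (Unique-resp-↭ p₁ u)

range-letters : ∀ n → HasLetters 0 n (map suc (upTo n))
range-letters n y = mk⇔ below above
  where
  below : y ∈ map suc (upTo n) → 0 < y × y ≤ n
  below y∈ with ∈-map⁻ suc y∈
  ... | _ , z∈ , refl = z<s , ∈-upTo⁻ z∈
  above : 0 < y × y ≤ n → y ∈ map suc (upTo n)
  above (s≤s z≤n , y≤n) = ∈-map⁺ suc (∈-upTo⁺ y≤n)

range-unique : ∀ n → Unique (map suc (upTo n))
range-unique n = Unique.map⁺ suc-injective (Unique.upTo⁺ n)

IsPermOf⇔ : IsPermOf n π ⇔ (Unique π × HasLetters 0 n π)
IsPermOf⇔ {n} = mk⇔
  (λ π↭ → Unique-resp-↭ (↭-sym π↭) (range-unique n) ,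
          λ y → ⇔-trans (mk⇔ (∈-resp-↭ π↭) (∈-resp-↭ (↭-sym π↭))) (range-letters n y))
  (λ (u , letters) → ∼bag⇒↭ (unique∧set⇒bag u (range-unique n)
                       (λ {y} → ⇔-trans (letters y) (⇔-sym (range-letters n y)))))

IsPermOf-length : IsPermOf n π → length π ≡ n
IsPermOf-length {n} π↭ = trans (↭-length π↭) (trans (length-map suc (upTo n)) (length-upTo n))

range-↭ : ∀ n → map suc (upTo (suc n)) ↭ suc n ∷ map suc (upTo n)
range-↭ n = subst (_↭ suc n ∷ map suc (upTo n)) range-snoc (↭-sym (∷↭∷ʳ (suc n) (map suc (upTo n))))
  where
  range-snoc : map suc (upTo n) ++ [ suc n ] ≡ map suc (upTo (suc n))
  range-snoc = trans (sym (map-++ suc (upTo n) [ n ])) (cong (map suc) (upTo-∷ʳ n))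

IsPermOf-∷-max : IsPermOf (suc n) (suc n ∷ τ) ⇔ IsPermOf n τ
IsPermOf-∷-max {n} = mk⇔ (λ π↭ → drop-∷ (↭-trans π↭ (range-↭ n)))
                         (λ τ↭ → ↭-trans (↭.prep (suc n) τ↭) (↭-sym (range-↭ n)))

IsPermOf⇒0∉ : IsPermOf N π → ¬ 0 ∈ π
IsPermOf⇒0∉ π↭ 0∈ = <-irrefl refl (proj₁ (to (proj₂ (to IsPermOf⇔ π↭) 0) 0∈))

IsPermOf⇒bounded : IsPermOf N π → All (_< suc N) π
IsPermOf⇒bounded π↭ = All.tabulate (λ y∈ → s≤s (proj₂ (to (proj₂ (to IsPermOf⇔ π↭) _) y∈)))

desc-perm : ∀ n → IsPermOf n (desc n 0)
desc-perm n = from IsPermOf⇔ (Decreasing⇒Unique (desc-decreasing n 0) ,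
                              subst (λ c → HasLetters 0 c (desc n 0)) (+-identityʳ n) (desc-letters n 0))

-- Patterns

[123] [231] [312] : List ℕ
[123] = 1 ∷ 2 ∷ 3 ∷ []
[231] = 2 ∷ 3 ∷ 1 ∷ []
[312] = 3 ∷ 1 ∷ 2 ∷ []

private
  1<2 : 1 < 2
  1<2 = s<s z<s
  1<3 : 1 < 3
  1<3 = s<s z<s
  2<3 : 2 < 3
  2<3 = s<s (s<s z<s)

  both-hold : {A B : Set} → A → B → A ⇔ B
  both-hold a b = mk⇔ (λ _ → b) (λ _ → a)

  both-fail : {A B : Set} → ¬ A → ¬ B → A ⇔ B
  both-fail ¬a ¬b = mk⇔ (⊥-elim ∘ ¬a) (⊥-elim ∘ ¬b)

sameOrder₃ : (x < y ⇔ p₁ < p₂) → (x < z ⇔ p₁ < p₃) → (y < z ⇔ p₂ < p₃) →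
             SameOrder (x ∷ y ∷ z ∷ []) (p₁ ∷ p₂ ∷ p₃ ∷ [])
sameOrder₃ xy xz yz = (xy ∷ xz ∷ []) , (yz ∷ []) , [] , tt

Contains-123⁻ : Contains π [123] → ∃₂ λ x y → ∃ λ z → x ∷ y ∷ z ∷ [] ⊆ π × x < y × y < z
Contains-123⁻ (_ ∷ _ ∷ _ ∷ [] , s , (xy ∷ _ ∷ []) , (yz ∷ []) , _) = _ , _ , _ , s , from xy 1<2 , from yz 2<3

Contains-123⁺ : x ∷ y ∷ z ∷ [] ⊆ π → x < y → y < z → Contains π [123]
Contains-123⁺ s x<y y<z =
  _ , s , sameOrder₃ (both-hold x<y 1<2) (both-hold (<-trans x<y y<z) 1<3) (both-hold y<z 2<3)

Contains-231⁻ : Contains π [231] → ∃₂ λ x y → ∃ λ z → x ∷ y ∷ z ∷ [] ⊆ π × x < y × ¬ x < z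
Contains-231⁻ (_ ∷ _ ∷ _ ∷ [] , s , (xy ∷ xz ∷ []) , _) = _ , _ , _ , s , from xy 2<3 , <-asym 1<2 ∘ to xz

Contains-231⁺ : x ∷ y ∷ z ∷ [] ⊆ π → x < y → z < x → Contains π [231]
Contains-231⁺ s x<y z<x = _ , s , sameOrder₃ (both-hold x<y 2<3) (both-fail (<-asym z<x) (<-asym 1<2))
                                             (both-fail (<-asym (<-trans z<x x<y)) (<-asym 1<3))

Contains-312⁻ : Contains π [312] → ∃₂ λ x y → ∃ λ z → x ∷ y ∷ z ∷ [] ⊆ π × y < z × ¬ x < z
Contains-312⁻ (_ ∷ _ ∷ _ ∷ [] , s , (_ ∷ xz ∷ []) , (yz ∷ []) , _) = _ , _ , _ , s , from yz 1<2 , <-asym 2<3 ∘ to xz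

Contains-312⁺ : x ∷ y ∷ z ∷ [] ⊆ π → y < z → z < x → Contains π [312]
Contains-312⁺ s y<z z<x = _ , s , sameOrder₃ (both-fail (<-asym (<-trans y<z z<x)) (<-asym 1<3))
                                             (both-fail (<-asym z<x) (<-asym 2<3)) (both-hold y<z 1<2)

pair₁₂ : x ∷ y ∷ z ∷ [] ⊆ π → x ∷ y ∷ [] ⊆ π
pair₁₂ = ⊆-trans (refl ∷ refl ∷ _ ∷ʳ [])

pair₁₃ : x ∷ y ∷ z ∷ [] ⊆ π → x ∷ z ∷ [] ⊆ π
pair₁₃ = ⊆-trans (refl ∷ _ ∷ʳ refl ∷ [])

pair₂₃ : x ∷ y ∷ z ∷ [] ⊆ π → y ∷ z ∷ [] ⊆ π
pair₂₃ = ⊆-trans (_ ∷ʳ refl ∷ refl ∷ [])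

Avoids-⊆ : xs ⊆ ys → Avoids ys σ → Avoids xs σ
Avoids-⊆ xs⊆ys av (w , w⊆xs , ord) = av (w , ⊆-trans w⊆xs xs⊆ys , ord)

Avoids-∷-max : p₁ < p₂ → All (_< x) τ → Avoids τ (p₁ ∷ p₂ ∷ p₃ ∷ []) → Avoids (x ∷ τ) (p₁ ∷ p₂ ∷ p₃ ∷ [])
Avoids-∷-max _     _   av (w , (_ ∷ʳ s) , ord) = av (w , s , ord)
Avoids-∷-max p₁<p₂ τ<x _  (_ ∷ _ ∷ _ ∷ [] , (refl ∷ s) , (xy ∷ _) , _) =
  <-asym (from xy p₁<p₂) (All.lookup τ<x (to∈ s))

Decreasing⇒avoids-123 : Decreasing π → Avoids π [123]
Decreasing⇒avoids-123 dec occ with Contains-123⁻ occ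
... | _ , _ , _ , s , x<y , _ = <-asym x<y (dec (pair₁₂ s))

Decreasing⇒avoids-312 : Decreasing π → Avoids π [312]
Decreasing⇒avoids-312 dec occ with Contains-312⁻ occ
... | _ , _ , _ , s , y<z , _ = <-asym y<z (dec (pair₂₃ s))

Avoids-[] : Avoids [] (p ∷ σ)
Avoids-[] (_ , [] , ())

Π231 Π312 : List (List ℕ)
Π231 = [123] ∷ [231] ∷ []
Π312 = [123] ∷ [312] ∷ []

-- The Jacobi condition

ρ-≮ : ¬ x < y → ρ x (y ∷ ys) ≡ []
ρ-≮ {x} {y} x≮y rewrite dec-false (x <? y) x≮y = refl

ρ-below : All (_< x) ys → ρ x ys ≡ []
ρ-below []          = refl
ρ-below (y<x ∷ _) = ρ-≮ (<-asym y<x)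

ρ-++ : All (x <_) ys → ρ x (ys ++ zs) ≡ ys ++ ρ x zs
ρ-++            []             = refl
ρ-++ {x} {y ∷ _} (x<y ∷ x<ys) rewrite dec-true (x <? y) x<y = cong (y ∷_) (ρ-++ x<ys)

Jacobi-∷⇔ : ρ x ys ≡ [] → Jacobi (x ∷ ys) ⇔ Jacobi ys
Jacobi-∷⇔ ρ≡[] = mk⇔ proj₂ (λ jac → subst (λ r → 2 ∣ length r) (sym ρ≡[]) (divides 0 refl) , jac)

Decreasing⇒Jacobi : Decreasing ys → Jacobi ys
Decreasing⇒Jacobi {[]}     _   = tt
Decreasing⇒Jacobi {_ ∷ _} dec =
  from (Jacobi-∷⇔ (ρ-below (Decreasing-head dec))) (Decreasing⇒Jacobi (Decreasing-tail dec))

Jacobi-desc-++ : ∀ k a → Jacobi (desc (suc k) a ++ ys) ⇔ (2 ∣ length (ρ (suc a) ys) × Jacobi ys)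
Jacobi-desc-++ zero    a = ⇔-refl
Jacobi-desc-++ (suc k) a = ⇔-trans (Jacobi-∷⇔ (ρ-≮ (<-asym (n<1+n (suc (k + a)))))) (Jacobi-desc-++ k a)

-- block i b m = (i + b … b + 1) (m + i + b … i + b + 1) (b … 1): a middle, a top and a bottom run
block : ℕ → ℕ → ℕ → List ℕ
block i b m = desc i b ++ desc m (i + b) ++ desc b 0

block-ascent : ∀ i b m → p ∷ q ∷ [] ⊆ block i b m → p < q → b < p × p ≤ i + b × i + b < q
block-ascent i b m s p<q with pair-++ (desc i b) s
... | inj₁ s′ = ⊥-elim (<-asym p<q (desc-decreasing i b s′))
... | inj₂ (inj₂ (p∈ , q∈)) = b<p , p≤i+b , i+b<q
  where
  b<p = proj₁ (∈-desc⁻ i p∈)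
  p≤i+b = proj₂ (∈-desc⁻ i p∈)
  i+b<q : i + b < _
  i+b<q with ∈-++⁻ (desc m (i + b)) q∈
  ... | inj₁ q∈top = proj₁ (∈-desc⁻ m q∈top)
  ... | inj₂ q∈bot = ⊥-elim (<-asym p<q (≤-<-trans (proj₂ (∈-desc₀⁻ b q∈bot)) b<p))
... | inj₂ (inj₁ s′) with pair-++ (desc m (i + b)) s′
...   | inj₁ s″              = ⊥-elim (<-asym p<q (desc-decreasing m (i + b) s″))
...   | inj₂ (inj₁ s″)       = ⊥-elim (<-asym p<q (desc-decreasing b 0 s″))
...   | inj₂ (inj₂ (p∈ , q∈)) = ⊥-elim (<-asym p<q
        (≤-<-trans (≤-trans (proj₂ (∈-desc₀⁻ b q∈)) (m≤n+m b i)) (proj₁ (∈-desc⁻ m p∈))))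

block-after-top : ∀ i b m → p ∷ q ∷ [] ⊆ block i b m → i + b < p → i + b < q ⊎ (0 < q × q ≤ b)
block-after-top i b m s i+b<p with pair-++ (desc i b) s
... | inj₁ s′              = ⊥-elim (<⇒≱ i+b<p (proj₂ (∈-desc⁻ i (to∈ s′))))
... | inj₂ (inj₂ (p∈ , _)) = ⊥-elim (<⇒≱ i+b<p (proj₂ (∈-desc⁻ i p∈)))
... | inj₂ (inj₁ s′) with pair-++ (desc m (i + b)) s′
...   | inj₁ s″             = inj₁ (proj₁ (∈-desc⁻ m (to∈ (∷ˡ⁻ s″))))
...   | inj₂ (inj₁ s″)      = ⊥-elim (<⇒≱ i+b<p (≤-trans (proj₂ (∈-desc₀⁻ b (to∈ s″))) (m≤n+m b i)))
...   | inj₂ (inj₂ (_ , q∈)) = inj₂ (∈-desc₀⁻ b q∈)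

block-avoids-123 : ∀ i b m → Avoids (block i b m) [123]
block-avoids-123 i b m occ with Contains-123⁻ occ
... | _ , _ , _ , s , x<y , y<z =
  <⇒≱ (proj₂ (proj₂ (block-ascent i b m (pair₁₂ s) x<y))) (proj₁ (proj₂ (block-ascent i b m (pair₂₃ s) y<z)))

block-avoids-312 : ∀ i b m → Avoids (block i b m) [312]
block-avoids-312 i b m occ with Contains-312⁻ occ
... | _ , _ , _ , s , y<z , x≮z with block-ascent i b m (pair₂₃ s) y<z
... | b<y , y≤i+b , i+b<z with block-after-top i b m (pair₁₂ s) (<-≤-trans i+b<z (≮⇒≥ x≮z))
... | inj₁ i+b<y      = <⇒≱ i+b<y y≤i+b
... | inj₂ (_ , y≤b) = <⇒≱ b<y y≤b

block-avoids-231 : ∀ i m → Avoids (block i 0 m) [231]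
block-avoids-231 i m occ with Contains-231⁻ occ
... | _ , _ , _ , s , x<y , x≮z with block-ascent i 0 m (pair₁₂ s) x<y
... | _ , x≤i , i<y with block-after-top i 0 m (pair₂₃ s) i<y
... | inj₁ i<z          = x≮z (≤-<-trans x≤i i<z)
... | inj₂ (0<z , z≤0) = <⇒≱ 0<z z≤0

block-perm : ∀ i b m → IsPermOf (m + (i + b)) (block i b m)
block-perm i b m = ↭-trans (shifts (desc i b) (desc m (i + b)))
                           (↭-trans (↭-reflexive merge-runs) (desc-perm (m + (i + b))))
  where
  merge-runs : desc m (i + b) ++ desc i b ++ desc b 0 ≡ desc (m + (i + b)) 0
  merge-runs = trans (cong (desc m (i + b) ++_) (desc-++ i b)) (desc-++ m (i + b))

Jacobi-block : ∀ i b m → Jacobi (block (suc i) b m) ⇔ 2 ∣ m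
Jacobi-block i b m = ⇔-trans (Jacobi-desc-++ i b)
  (mk⇔ (subst (2 ∣_) top-run ∘ proj₁) (λ even → subst (2 ∣_) (sym top-run) even , Decreasing⇒Jacobi tail-decreasing))
  where
  b<top : All (suc b <_) (desc m (suc i + b))
  b<top = All.tabulate (λ y∈ → ≤-<-trans (s≤s (m≤n+m b i)) (proj₁ (∈-desc⁻ m y∈)))
  bottom<b : All (_< suc b) (desc b 0)
  bottom<b = All.tabulate (λ y∈ → s≤s (proj₂ (∈-desc₀⁻ b y∈)))
  top-run : length (ρ (suc b) (desc m (suc i + b) ++ desc b 0)) ≡ m
  top-run = begin
    length (ρ (suc b) (desc m (suc i + b) ++ desc b 0)) ≡⟨ cong length (ρ-++ b<top) ⟩
    length (desc m (suc i + b) ++ ρ (suc b) (desc b 0)) ≡⟨ cong (λ r → length (desc m (suc i + b) ++ r)) (ρ-below bottom<b) ⟩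
    length (desc m (suc i + b) ++ [])                   ≡⟨ cong length (++-identityʳ (desc m (suc i + b))) ⟩
    length (desc m (suc i + b))                          ≡⟨ length-desc m _ ⟩
    m                                                    ∎
    where open ≡-Reasoning
  tail-decreasing : Decreasing (desc m (suc i + b) ++ desc b 0)
  tail-decreasing = Decreasing-++ (desc-decreasing m _) (desc-decreasing b 0)
    (λ p∈ q∈ → <-trans (All.lookup bottom<b q∈) (All.lookup b<top p∈))

IsBlock : ℕ → ℕ → List ℕ → Set
IsBlock N b π = ∃₂ λ i q → π ≡ block (suc i) b (suc q * 2) × N ≡ suc q * 2 + (suc i + b)

Jacobi-block⇒IsBlock : 0 < m → Jacobi π → π ≡ block (suc i) b m → N ≡ m + suc (i + b) → IsBlock N b π
Jacobi-block⇒IsBlock {m = suc k} {i = i} {b = b} _ jac refl refl with to (Jacobi-block i b (suc k)) jac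
... | divides (suc q) eq = i , q , cong (block (suc i) b) eq , cong (_+ suc (i + b)) eq

IsBlock-head<N : IsBlock N b (x ∷ τ) → x < N
IsBlock-head<N {b = b} (i , q , x∷τ≡ , refl) =
  subst (_< suc q * 2 + suc (i + b)) (sym (∷-injectiveˡ x∷τ≡)) (m<n+m (suc (i + b)) {suc q * 2} z<s)

IsBlock⇒avoider312 : IsBlock N b π → JacobiAvoider N Π312 π
IsBlock⇒avoider312 {b = b} (i , q , refl , refl) =
  block-perm (suc i) b _ , from (Jacobi-block i b _) (divides (suc q) refl) ,
  block-avoids-123 (suc i) b _ , block-avoids-312 (suc i) b _ , tt

IsBlock⇒avoider231 : IsBlock N 0 π → JacobiAvoider N Π231 π
IsBlock⇒avoider231 (i , q , refl , refl) =
  block-perm (suc i) 0 _ , from (Jacobi-block i 0 _) (divides (suc q) refl) ,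
  block-avoids-123 (suc i) 0 _ , block-avoids-231 (suc i) _ , tt

Shape312 : ℕ → List ℕ → Set
Shape312 N π = π ≡ desc N 0 ⊎ ∃ λ b → IsBlock N b π

Jacobi-block⇒Shape312 : Jacobi π → π ≡ block (suc i) b m → N ≡ m + suc (i + b) → Shape312 N π
Jacobi-block⇒Shape312 {i = i} {b = b} {m = zero} _ refl refl = inj₁ (desc-++ (suc i) b)
Jacobi-block⇒Shape312 {m = suc k} jac π≡ N≡ = inj₂ (_ , Jacobi-block⇒IsBlock z<s jac π≡ N≡)

-- Jacobi avoiders of 123 and 231 or 312

above-head-descent : Unique (x ∷ τ) → Avoids (x ∷ τ) [123] → y ∷ z ∷ [] ⊆ τ → x < y → x < z → z < y
above-head-descent {y = y} {z = z} (_ ∷ u) av s x<y x<z with <-cmp y z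
... | tri< y<z _ _ = ⊥-elim (av (Contains-123⁺ (refl ∷ s) x<y y<z))
... | tri≈ _ y≡z _ = ⊥-elim (Unique-pair⇒≢ u s y≡z)
... | tri> _ _ z<y = z<y

module _ {N x′ : ℕ} {S₁ L S₂ : List ℕ}
         (letters : HasLetters 0 N (suc x′ ∷ S₁ ++ L ++ S₂))
         (S₁<x : All (_< suc x′) S₁) (x<L : All (suc x′ <_) L) (S₂<x : All (_< suc x′) S₂) where

  private
    x≤N : suc x′ ≤ N
    x≤N = proj₂ (to (letters (suc x′)) (here refl))

  ∈-parts : y ∈ suc x′ ∷ S₁ ++ L ++ S₂ → y ≢ suc x′ → (y < suc x′ × y ∈ S₁ ++ S₂) ⊎ (suc x′ < y × y ∈ L)
  ∈-parts (here y≡x) y≢x = ⊥-elim (y≢x y≡x)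
  ∈-parts (there y∈) _ with ∈-++⁻ S₁ y∈
  ... | inj₁ y∈S₁ = inj₁ (All.lookup S₁<x y∈S₁ , ∈-++⁺ˡ y∈S₁)
  ... | inj₂ y∈′ with ∈-++⁻ L y∈′
  ...   | inj₁ y∈L  = inj₂ (All.lookup x<L y∈L , y∈L)
  ...   | inj₂ y∈S₂ = inj₁ (All.lookup S₂<x y∈S₂ , ∈-++⁺ʳ S₁ y∈S₂)

  letters-above : HasLetters (suc x′) N L
  letters-above y = mk⇔ (λ y∈ → All.lookup x<L y∈ , proj₂ (to (letters y) (there (lookup (middle-⊆ S₁ L S₂) y∈))))
                        above
    where
    above : suc x′ < y × y ≤ N → y ∈ L
    above (x<y , y≤N) with ∈-parts (from (letters y) (≤-<-trans z≤n x<y , y≤N)) (>⇒≢ x<y)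
    ... | inj₁ (y<x , _) = ⊥-elim (<-asym x<y y<x)
    ... | inj₂ (_ , y∈L) = y∈L

  letters-below : HasLetters 0 x′ (S₁ ++ S₂)
  letters-below y = mk⇔ (λ y∈ → proj₁ (to (letters y) (there (lookup (outer-⊆ S₁ L S₂) y∈))) ,
                                 ≤-pred (All.lookup (All-++⁺ S₁<x S₂<x) y∈))
                        below
    where
    below : 0 < y × y ≤ x′ → y ∈ S₁ ++ S₂
    below (0<y , y≤x′) with ∈-parts (from (letters y) (0<y , ≤-trans (m≤n⇒m≤1+n y≤x′) x≤N)) (<⇒≢ (s≤s y≤x′))
    ... | inj₁ (_ , y∈S) = y∈S
    ... | inj₂ (x<y , _) = ⊥-elim (<-asym x<y (s≤s y≤x′))

  block-recognition : Unique (suc x′ ∷ S₁ ++ L ++ S₂) → Avoids (suc x′ ∷ S₁ ++ L ++ S₂) [123] →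
    Decreasing (S₁ ++ S₂) →
    ∃₂ λ i b → suc x′ ∷ S₁ ++ L ++ S₂ ≡ block (suc i) b (N ∸ suc x′) ×
               N ≡ (N ∸ suc x′) + suc (i + b) × S₂ ≡ desc b 0
  block-recognition u av decS
    with desc-++⁻ S₁ (decreasing-letters⇒desc x′ decS (subst (λ c → HasLetters 0 c _) (sym (+-identityʳ x′)) letters-below))
       | decreasing-letters⇒desc (N ∸ suc x′) decL (subst (λ c → HasLetters _ c L) (sym (m∸n+n≡m x≤N)) letters-above)
    where
    decL : Decreasing L
    decL s = above-head-descent u av (⊆-trans s (middle-⊆ S₁ L S₂))
               (All.lookup x<L (to∈ s)) (All.lookup x<L (to∈ (∷ˡ⁻ s)))
  ... | i , b , refl , refl , refl | refl = i , b , refl , sym (m∸n+n≡m x≤N) , refl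

avoider312⇒Shape312 : JacobiAvoider N Π312 π → Shape312 N π
avoider312⇒Shape312 {π = []}     (π↭ , _) = inj₁ (cong (λ n → desc n 0) (IsPermOf-length π↭))
avoider312⇒Shape312 {π = 0 ∷ _} (π↭ , _) = ⊥-elim (IsPermOf⇒0∉ π↭ (here refl))
avoider312⇒Shape312 {π = suc x′ ∷ τ} (π↭ , jac , a123 , a312 , _)
  with to IsPermOf⇔ π↭
... | u@(_ ∷ τ-unique) , letters
  with split-PQP (_< suc x′) (suc x′ <_) (compare-with-head u) high-low-high
  where
  high-low-high : y ∷ z ∷ w ∷ [] ⊆ τ → suc x′ < y → z < suc x′ → suc x′ < w → ⊥
  high-low-high s x<y z<x x<w =
    a312 (Contains-312⁺ (_ ∷ʳ s) (<-trans z<x x<w) (above-head-descent u a123 (pair₁₃ s) x<y x<w))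
... | S₁ , L , S₂ , refl , S₁<x , x<L , S₂<x
  with block-recognition letters S₁<x x<L S₂<x u a123 lows-decreasing
  where
  lows-decreasing : Decreasing (S₁ ++ S₂)
  lows-decreasing = no-ascent⇒Decreasing (Unique-⊆ (outer-⊆ S₁ L S₂) τ-unique) λ s p<q →
    a312 (Contains-312⁺ (refl ∷ ⊆-trans s (outer-⊆ S₁ L S₂)) p<q (All.lookup (All-++⁺ S₁<x S₂<x) (to∈ (∷ˡ⁻ s))))
... | i , b , π≡ , N≡ , _ = Jacobi-block⇒Shape312 {i = i} {b = b} jac π≡ N≡

Shape312⇔avoider : Shape312 N π ⇔ JacobiAvoider N Π312 π
Shape312⇔avoider {N} = mk⇔ sound avoider312⇒Shape312
  where
  sound : Shape312 N π → JacobiAvoider N Π312 π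
  sound (inj₁ refl) = desc-perm N , Decreasing⇒Jacobi (desc-decreasing N 0) ,
                      Decreasing⇒avoids-123 (desc-decreasing N 0) , Decreasing⇒avoids-312 (desc-decreasing N 0) , tt
  sound (inj₂ (_ , blk)) = IsBlock⇒avoider312 blk

avoider231⇒IsBlock : JacobiAvoider N Π231 (x ∷ τ) → x < N → IsBlock N 0 (x ∷ τ)
avoider231⇒IsBlock {x = 0} (π↭ , _) _ = ⊥-elim (IsPermOf⇒0∉ π↭ (here refl))
avoider231⇒IsBlock {N} {suc x′} {τ} (π↭ , jac , a123 , a231 , _) x<N
  with to IsPermOf⇔ π↭
... | u@(_ ∷ τ-unique) , letters
  with split-PQ (_< suc x′) (suc x′ <_) (compare-with-head u) (λ s x<y z<x → a231 (Contains-231⁺ (refl ∷ s) x<y z<x))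
... | S₁ , L , τ≡ , S₁<x , x<L
  -- read τ = S₁ ++ L as S₁ ++ L ++ [] to reuse block-recognition
  with trans τ≡ (cong (S₁ ++_) (sym (++-identityʳ L)))
... | refl
  with block-recognition letters S₁<x x<L [] u a123 lows-decreasing
  where
  N∈L : N ∈ L
  N∈L with ∈-parts letters S₁<x x<L [] (from (letters N) (<-trans z<s x<N , ≤-refl)) (>⇒≢ x<N)
  ... | inj₁ (N<x , _) = ⊥-elim (<-asym x<N N<x)
  ... | inj₂ (_ , N∈L) = N∈L
  lows-decreasing : Decreasing (S₁ ++ [])
  lows-decreasing = no-ascent⇒Decreasing (Unique-⊆ (outer-⊆ S₁ L []) τ-unique)
                      (λ s → lows-ascent (subst (_ ⊆_) (++-identityʳ S₁) s))
    where
    lows-ascent : p ∷ q ∷ [] ⊆ S₁ → p < q → ⊥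
    lows-ascent s p<q = a123 (Contains-123⁺ (_ ∷ʳ ⊆-++⁺ s (from∈ (∈-++⁺ˡ N∈L)))
                                            p<q (<-trans (All.lookup S₁<x (to∈ (∷ˡ⁻ s))) x<N))
... | i , zero  , π≡ , N≡ , _  = Jacobi-block⇒IsBlock (m<n⇒0<n∸m x<N) jac π≡ N≡
... | i , suc b , _  , _  , ()

-- Enumeration

blockHeads : ℕ → List ℕ
blockHeads 0                   = []
blockHeads 1                   = []
blockHeads 2                   = []
blockHeads (suc (suc (suc k))) = k ∷ blockHeads (suc k)

∈-blockHeads⁺ : ∀ q i → i ∈ blockHeads (suc q * 2 + suc i)
∈-blockHeads⁺ zero    i = here refl
∈-blockHeads⁺ (suc q) i = there (∈-blockHeads⁺ q i)

∈-blockHeads⁻ : ∀ N → i ∈ blockHeads N → ∃ λ q → N ≡ suc q * 2 + suc i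
∈-blockHeads⁻ (suc (suc (suc k))) (here refl) = 0 , refl
∈-blockHeads⁻ (suc (suc (suc k))) (there i∈) with ∈-blockHeads⁻ (suc k) i∈
... | q , refl = suc q , refl

blockHeads-unique : ∀ N → Unique (blockHeads N)
blockHeads-unique 0 = []
blockHeads-unique 1 = []
blockHeads-unique 2 = []
blockHeads-unique (suc (suc (suc k))) = All.tabulate k∉ ∷ blockHeads-unique (suc k)
  where
  k∉ : i ∈ blockHeads (suc k) → k ≢ i
  k∉ {i} i∈ with ∈-blockHeads⁻ (suc k) i∈
  ... | q , refl = >⇒≢ (s≤s (≤-trans (n≤1+n i) (m≤n+m (suc i) (q * 2))))

blockHeads-length : ∀ n → length (blockHeads (suc n)) ≡ ⌊ n /2⌋
blockHeads-length 0             = refl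
blockHeads-length 1             = refl
blockHeads-length (suc (suc n)) = cong suc (blockHeads-length n)

baseBlocks : ℕ → List (List ℕ)
baseBlocks N = map (λ i → block (suc i) 0 (N ∸ suc i)) (blockHeads N)

∈-baseBlocks : π ∈ baseBlocks N ⇔ IsBlock N 0 π
∈-baseBlocks {N = N} = mk⇔ sound complete
  where
  sound : π ∈ baseBlocks N → IsBlock N 0 π
  sound π∈ with ∈-map⁻ _ π∈
  ... | i , i∈ , refl with ∈-blockHeads⁻ N i∈
  ...   | q , refl = i , q , cong (block (suc i) 0) (m+n∸n≡m _ (suc i)) , cong (suc q * 2 +_) (sym (+-identityʳ (suc i)))
  complete : IsBlock N 0 π → π ∈ baseBlocks N
  complete (i , q , refl , refl) =
    subst (λ n → block (suc i) 0 (suc q * 2) ∈ baseBlocks n) (cong (suc q * 2 +_) (sym (+-identityʳ (suc i))))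
      (subst (_∈ baseBlocks (suc q * 2 + suc i)) (cong (block (suc i) 0) (m+n∸n≡m (suc q * 2) (suc i)))
        (∈-map⁺ (λ j → block (suc j) 0 (suc q * 2 + suc i ∸ suc j)) (∈-blockHeads⁺ q i)))

baseBlocks-unique : ∀ N → Unique (baseBlocks N)
baseBlocks-unique N = Unique.map⁺ head-injective (blockHeads-unique N)
  where
  head-injective : block (suc i) 0 m ≡ block (suc j) 0 n → i ≡ j
  head-injective {i} {j = j} eq = trans (sym (+-identityʳ i)) (trans (suc-injective (∷-injectiveˡ eq)) (+-identityʳ j))

baseBlocks-length : ∀ n → length (baseBlocks (suc n)) ≡ ⌊ n /2⌋
baseBlocks-length n = trans (length-map _ (blockHeads (suc n))) (blockHeads-length n)

avoider231-∷-max : JacobiAvoider (suc n) Π231 (suc n ∷ τ) ⇔ JacobiAvoider n Π231 τ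
avoider231-∷-max = mk⇔
  (λ (π↭ , jac , a123 , a231 , _) →
     to IsPermOf-∷-max π↭ , proj₂ jac , Avoids-⊆ (_ ∷ʳ ⊆-refl) a123 , Avoids-⊆ (_ ∷ʳ ⊆-refl) a231 , tt)
  (λ (τ↭ , jac , a123 , a231 , _) →
     let τ<x = IsPermOf⇒bounded τ↭ in
     from IsPermOf-∷-max τ↭ , from (Jacobi-∷⇔ (ρ-below τ<x)) jac ,
     Avoids-∷-max 1<2 τ<x a123 , Avoids-∷-max 2<3 τ<x a231 , tt)

avoiders231 : ℕ → List (List ℕ)
avoiders231 zero    = [] ∷ []
avoiders231 (suc n) = map (suc n ∷_) (avoiders231 n) ++ baseBlocks (suc n)

∈-avoiders231 : ∀ N → π ∈ avoiders231 N ⇔ JacobiAvoider N Π231 π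
∈-avoiders231 N = mk⇔ (sound N) (complete N)
  where
  sound : ∀ N → π ∈ avoiders231 N → JacobiAvoider N Π231 π
  sound zero    (here refl) = ↭.refl , tt , Avoids-[] , Avoids-[] , tt
  sound (suc n) π∈ with ∈-++⁻ (map (suc n ∷_) (avoiders231 n)) π∈
  ... | inj₂ π∈blocks = IsBlock⇒avoider231 (to ∈-baseBlocks π∈blocks)
  ... | inj₁ π∈cons with ∈-map⁻ (suc n ∷_) π∈cons
  ...   | τ , τ∈ , refl = from avoider231-∷-max (sound n τ∈)
  complete : ∀ N → JacobiAvoider N Π231 π → π ∈ avoiders231 N
  complete {[]}    zero    _        = here refl
  complete {_ ∷ _} zero    (π↭ , _) with IsPermOf-length π↭
  ... | ()
  complete {[]}    (suc n) (π↭ , _) with IsPermOf-length π↭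
  ... | ()
  complete {x ∷ τ} (suc n) ja@(π↭ , _) with m≤n⇒m<n∨m≡n (≤-pred (All.lookup (IsPermOf⇒bounded π↭) (here refl)))
  ... | inj₁ x<N = ∈-++⁺ʳ _ (from ∈-baseBlocks (avoider231⇒IsBlock ja x<N))
  ... | inj₂ refl = ∈-++⁺ˡ (∈-map⁺ (suc n ∷_) (complete n (to avoider231-∷-max ja)))

avoiders231-unique : ∀ N → Unique (avoiders231 N)
avoiders231-unique zero    = [] ∷ []
avoiders231-unique (suc n) = Unique.++⁺ (Unique.map⁺ ∷-injectiveʳ (avoiders231-unique n)) (baseBlocks-unique (suc n))
  λ (π∈cons , π∈blocks) → case ∈-map⁻ (suc n ∷_) π∈cons of λ
    { (τ , _ , refl) → <-irrefl refl (IsBlock-head<N (to ∈-baseBlocks π∈blocks)) }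

length-avoiders231 : ∀ n → length (avoiders231 (suc n)) ≡ length (avoiders231 n) + ⌊ n /2⌋
length-avoiders231 n = trans (length-++ (map (suc n ∷_) (avoiders231 n)))
                             (cong₂ _+_ (length-map (suc n ∷_) (avoiders231 n)) (baseBlocks-length n))

appendMin : List ℕ → List ℕ
appendMin π = map suc π ++ [ 1 ]

appendMin-injective : appendMin xs ≡ appendMin ys → xs ≡ ys
appendMin-injective {xs} {ys} eq = map-injective suc-injective (proj₁ (∷ʳ-injective (map suc xs) (map suc ys) eq))

appendMin-desc : ∀ n → appendMin (desc n 0) ≡ desc (suc n) 0
appendMin-desc n = trans (cong (_++ [ 1 ]) (map-suc-desc n 0)) (sym (desc-snoc n 0))

appendMin-block : ∀ i b m → appendMin (block i b m) ≡ block i (suc b) m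
appendMin-block i b m = begin
  map suc (desc i b ++ desc m (i + b) ++ desc b 0) ++ [ 1 ]
    ≡⟨ cong (_++ [ 1 ]) (map-++ suc (desc i b) (desc m (i + b) ++ desc b 0)) ⟩
  (map suc (desc i b) ++ map suc (desc m (i + b) ++ desc b 0)) ++ [ 1 ]
    ≡⟨ cong (λ r → (map suc (desc i b) ++ r) ++ [ 1 ]) (map-++ suc (desc m (i + b)) (desc b 0)) ⟩
  (map suc (desc i b) ++ map suc (desc m (i + b)) ++ map suc (desc b 0)) ++ [ 1 ]
    ≡⟨ ++-assoc (map suc (desc i b)) (map suc (desc m (i + b)) ++ map suc (desc b 0)) [ 1 ] ⟩
  map suc (desc i b) ++ (map suc (desc m (i + b)) ++ map suc (desc b 0)) ++ [ 1 ]
    ≡⟨ cong (map suc (desc i b) ++_) (++-assoc (map suc (desc m (i + b))) (map suc (desc b 0)) [ 1 ]) ⟩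
  map suc (desc i b) ++ map suc (desc m (i + b)) ++ appendMin (desc b 0)
    ≡⟨ cong₂ (λ r s → r ++ s ++ appendMin (desc b 0)) (map-suc-desc i b) (map-suc-desc m (i + b)) ⟩
  desc i (suc b) ++ desc m (suc (i + b)) ++ appendMin (desc b 0)
    ≡⟨ cong₂ (λ r s → desc i (suc b) ++ desc m r ++ s) (sym (+-suc i b)) (appendMin-desc b) ⟩
  block i (suc b) m ∎
  where open ≡-Reasoning

block-last : ∀ i k → block (suc i) 0 (suc k) ≡ (desc (suc i) 0 ++ desc k (suc (suc i + 0))) ++ [ suc (suc i + 0) ]
block-last i k = begin
  desc (suc i) 0 ++ desc (suc k) (suc i + 0) ++ []
    ≡⟨ cong (desc (suc i) 0 ++_) (++-identityʳ (desc (suc k) (suc i + 0))) ⟩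
  desc (suc i) 0 ++ desc (suc k) (suc i + 0)
    ≡⟨ cong (desc (suc i) 0 ++_) (desc-snoc k (suc i + 0)) ⟩
  desc (suc i) 0 ++ desc k (suc (suc i + 0)) ++ [ suc (suc i + 0) ]
    ≡⟨ sym (++-assoc (desc (suc i) 0) (desc k (suc (suc i + 0))) [ suc (suc i + 0) ]) ⟩
  (desc (suc i) 0 ++ desc k (suc (suc i + 0))) ++ [ suc (suc i + 0) ] ∎
  where open ≡-Reasoning

block-size-suc : ∀ m i b → m + (suc i + suc b) ≡ suc (m + (suc i + b))
block-size-suc m i b = trans (cong (λ r → m + suc r) (+-suc i b)) (+-suc m (suc i + b))

IsBlock-appendMin : IsBlock n b π → IsBlock (suc n) (suc b) (appendMin π)
IsBlock-appendMin {b = b} (i , q , refl , refl) =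
  i , q , appendMin-block (suc i) b (suc q * 2) , sym (block-size-suc (suc q * 2) i b)

IsBlock-appendMin⁻ : IsBlock (suc n) (suc b) π → ∃ λ τ → π ≡ appendMin τ × IsBlock n b τ
IsBlock-appendMin⁻ {b = b} (i , q , refl , N≡) =
  block (suc i) b (suc q * 2) , sym (appendMin-block (suc i) b (suc q * 2)) ,
  i , q , refl , suc-injective (trans N≡ (block-size-suc (suc q * 2) i b))

appendMin≢block : appendMin τ ≢ block (suc i) 0 (suc k)
appendMin≢block {τ} {i} {k} eq =
  0≢1+n (suc-injective (proj₂ (∷ʳ-injective (map suc τ) (desc (suc i) 0 ++ desc k (suc (suc i + 0)))
                                            (trans eq (block-last i k)))))

avoiders312 : ℕ → List (List ℕ)
avoiders312 zero    = [] ∷ []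
avoiders312 (suc n) = map appendMin (avoiders312 n) ++ baseBlocks (suc n)

∈-avoiders312 : ∀ N → π ∈ avoiders312 N ⇔ Shape312 N π
∈-avoiders312 N = mk⇔ (sound N) (complete N)
  where
  sound : ∀ N → π ∈ avoiders312 N → Shape312 N π
  sound zero    (here refl) = inj₁ refl
  sound (suc n) π∈ with ∈-++⁻ (map appendMin (avoiders312 n)) π∈
  ... | inj₂ π∈blocks = inj₂ (0 , to ∈-baseBlocks π∈blocks)
  ... | inj₁ π∈lifted with ∈-map⁻ appendMin π∈lifted
  ...   | τ , τ∈ , refl with sound n τ∈
  ...     | inj₁ refl      = inj₁ (appendMin-desc n)
  ...     | inj₂ (b , blk) = inj₂ (suc b , IsBlock-appendMin blk)
  complete : ∀ N → Shape312 N π → π ∈ avoiders312 N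
  complete zero    (inj₁ refl)                 = here refl
  complete zero    (inj₂ (_ , _ , _ , _ , ()))
  complete (suc n) (inj₁ refl) =
    ∈-++⁺ˡ (subst (_∈ map appendMin (avoiders312 n)) (appendMin-desc n) (∈-map⁺ appendMin (complete n (inj₁ refl))))
  complete (suc n) (inj₂ (zero , blk)) = ∈-++⁺ʳ _ (from ∈-baseBlocks blk)
  complete (suc n) (inj₂ (suc b , blk)) with IsBlock-appendMin⁻ blk
  ... | τ , refl , blk′ = ∈-++⁺ˡ (∈-map⁺ appendMin (complete n (inj₂ (b , blk′))))

avoiders312-unique : ∀ N → Unique (avoiders312 N)
avoiders312-unique zero    = [] ∷ []
avoiders312-unique (suc n) = Unique.++⁺ (Unique.map⁺ appendMin-injective (avoiders312-unique n)) (baseBlocks-unique (suc n))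
  λ (π∈lifted , π∈blocks) → case ∈-map⁻ appendMin π∈lifted , to ∈-baseBlocks π∈blocks of λ
    { ((_ , _ , refl) , (_ , _ , π≡ , _)) → appendMin≢block π≡ }

length-avoiders312 : ∀ n → length (avoiders312 (suc n)) ≡ length (avoiders312 n) + ⌊ n /2⌋
length-avoiders312 n = trans (length-++ (map appendMin (avoiders312 n)))
                             (cong₂ _+_ (length-map appendMin (avoiders312 n)) (baseBlocks-length n))

-- Counting

square/4-step : ∀ n → (2 + n) * (2 + n) / 4 ≡ n * n / 4 + suc n
square/4-step n = begin
  (2 + n) * (2 + n) / 4       ≡⟨ cong (_/ 4) (expand n) ⟩
  (n * n + suc n * 4) / 4     ≡⟨ +-distrib-/-∣ʳ (n * n) (divides (suc n) refl) ⟩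
  n * n / 4 + suc n * 4 / 4   ≡⟨ cong (n * n / 4 +_) (m*n/n≡m (suc n) 4) ⟩
  n * n / 4 + suc n           ∎
  where
  open ≡-Reasoning
  open +-*-Solver
  expand : ∀ n → (2 + n) * (2 + n) ≡ n * n + suc n * 4
  expand = solve 1 (λ n → (con 2 :+ n) :* (con 2 :+ n) := n :* n :+ (con 1 :+ n) :* con 4) refl

quarter-squares : (c : ℕ → ℕ) → c 0 ≡ 1 → (∀ n → c (suc n) ≡ c n + ⌊ n /2⌋) →
                  ∀ n → c n ≡ 1 + (n ∸ 1) * (n ∸ 1) / 4
quarter-squares c c0 step 0 = c0
quarter-squares c c0 step 1 = trans (step 0) (cong (_+ 0) c0)
quarter-squares c c0 step 2 = trans (step 1) (cong (_+ 0) (quarter-squares c c0 step 1))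
quarter-squares c c0 step (suc (suc (suc n))) = begin
  c (3 + n)                               ≡⟨ step (2 + n) ⟩
  c (2 + n) + ⌊ 2 + n /2⌋                 ≡⟨ cong (_+ ⌊ 2 + n /2⌋) (step (1 + n)) ⟩
  c (1 + n) + ⌊ 1 + n /2⌋ + ⌈ 1 + n /2⌉   ≡⟨ +-assoc (c (1 + n)) ⌊ 1 + n /2⌋ ⌈ 1 + n /2⌉ ⟩
  c (1 + n) + (⌊ 1 + n /2⌋ + ⌈ 1 + n /2⌉) ≡⟨ cong₂ _+_ (quarter-squares c c0 step (suc n)) (⌊n/2⌋+⌈n/2⌉≡n (1 + n)) ⟩
  1 + n * n / 4 + suc n                   ≡⟨ cong suc (sym (square/4-step n)) ⟩
  1 + (2 + n) * (2 + n) / 4               ∎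
  where open ≡-Reasoning

theorem8p5 : (n : ℕ) (σ : List ℕ) →
    (σ ≡ 2 ∷ 3 ∷ 1 ∷ [] ⊎ σ ≡ 3 ∷ 1 ∷ 2 ∷ []) →
    JCount n ((1 ∷ 2 ∷ 3 ∷ []) ∷ σ ∷ []) (1 + ((n ∸ 1) * (n ∸ 1)) / 4)
theorem8p5 n σ (inj₁ refl) =
  avoiders231 n , avoiders231-unique n , (λ π → ∈-avoiders231 n) ,
  quarter-squares (length ∘ avoiders231) refl length-avoiders231 n
theorem8p5 n σ (inj₂ refl) =
  avoiders312 n , avoiders312-unique n , (λ π → ⇔-trans (∈-avoiders312 n) Shape312⇔avoider) ,
  quarter-squares (length ∘ avoiders312) refl length-avoiders312 n
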